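{- Let $n=p_1^{n_1}\cdots p_r^{n_r}$ with $r\geq 3$, primes $p_1<\cdots<p_r$ and positive integers $n_i$. Let $a,b\in[r]$ with $a<b$. If $p_a^s<p_b$ for some $s\in[n_a]$, then $\beta_a^s>\beta_b^1$.
   Context: $[m]=\{1,\dots,m\}$, $\phi$ is Euler's totient function. For $a\in[r]$ and $s\in[n_a]$, $$\beta_a^s:=\phi(n)+\frac{n}{p_1\cdots p_r}\cdot\frac{1}{p_a^{s-1}}\left[\frac{p_1\cdots p_r}{p_a}+\phi\left(\frac{p_1\cdots p_r}{p_a}\right)(p_a^{s-1}-2)\right].$$ -}

module Defs where

open import Data.Nat as ℕ using (ℕ; zero; suc; _+_; _*_; _∸_; _^_)
open import Data.Nat.DivMod using () renaming (_/_ to _/ℕ_)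
open import Data.Nat.Coprimality using (coprime?)
open import Data.Fin using (Fin) renaming (zero to fzero; suc to fsuc)
open import Data.List using (List; length; filter; map; upTo)
open import Data.Integer as ℤ using (ℤ; +_)
open import Data.Rational as ℚ using (ℚ; _/_)

fromℕℚ : ℕ → ℚ
fromℕℚ m = (+ m) / 1

φ : ℕ → ℕ
φ n = length (filter (λ k → coprime? k n) (map suc (upTo n)))

prod : (r : ℕ) → (Fin r → ℕ) → ℕ
prod zero    f = 1
prod (suc r) f = f fzero * prod r (λ i → f (fsuc i))

-- natural-number division (total; the divisor is never 0 in our uses,
-- all divisors are products of primes)
divℕ : ℕ → ℕ → ℕ
divℕ m zero    = 0
divℕ m (suc k) = m /ℕ suc k

-- rational division of a natural by a natural (divisor never 0 in our uses)
divℚ : ℕ → ℕ → ℚ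
divℚ m zero    = ℚ.0ℚ
divℚ m (suc k) = (+ m) / suc k

nOf : (r : ℕ) → (Fin r → ℕ) → (Fin r → ℕ) → ℕ
nOf r p e = prod r (λ i → p i ^ e i)

radOf : (r : ℕ) → (Fin r → ℕ) → ℕ
radOf r p = prod r p

β : (r : ℕ) → (p e : Fin r → ℕ) → (a : Fin r) → (s : ℕ) → ℚ
β r p e a s =
  fromℕℚ (φ n) ℚ.+
    divℚ n (P * p a ^ (s ∸ 1)) ℚ.*
      (fromℕℚ Q ℚ.+ fromℕℚ (φ Q) ℚ.* (fromℕℚ (p a ^ (s ∸ 1)) ℚ.- fromℕℚ 2))
  where
    n = nOf r p e
    P = radOf r p
    Q = divℕ P (p a)

-- Write P = p₁⋯p_r, Q_a = P/p_a = p_b R and Q_b = P/p_b = p_a R, where R ≥ 2 is the product of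
-- the remaining primes (there is one since r ≥ 3). As φ(p R) = (p − 1) φ(R) for a prime p ∤ R,
-- cancelling the common term φ(n) and the positive factor n/(P x), x = p_a^{s−1}, turns
-- β_a^s > β_b^1 into x (Q_b − φ(Q_b)) < Q_a + φ(Q_a) (x − 2). For x ≥ 2 this already follows
-- from x p_a < p_b; for x = 1 it says (p_b − p_a)(R − φ(R)) > 0, and φ(R) < R because R ≥ 2.

module Submission where

open import Defs
open import Data.Nat
  using (ℕ; zero; suc; _+_; _*_; _^_; _≤_; _<_; _>_; z≤n; s≤s; nonTrivial⇒≢1; nonTrivial⇒n>1; >-nonZero)
open import Data.Nat.Properties
open import Data.Nat.Divisibility
open import Data.Nat.Coprimality as Coprimality using (Coprime; coprime?; coprime-divisor)
open import Data.Nat.Primality using (Prime; prime⇒irreducible; prime⇒nonTrivial; euclidsLemma)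
open import Data.List using (length; filter; map; applyUpTo)
open import Data.Nat.DivMod using (_/_; m*n/n≡m)
open import Data.Fin.Patterns using (0F; 1F; 2F)
open import Data.Fin using (Fin) renaming (zero to fzero; suc to fsuc; _<_ to _<ᶠ_)
import Data.Fin.Properties as Fin
open import Data.Vec.Functional using (updateAt)
open import Data.Vec.Functional.Properties using (updateAt-updates; updateAt-minimal)
open import Data.Product using (_×_; _,_; proj₁; proj₂; ∃-syntax)
open import Data.Sum using (_⊎_; inj₁; inj₂; [_,_])
open import Relation.Binary.Definitions using (tri<; tri≈; tri>)
open import Data.Empty using (⊥-elim)
open import Function using (_∘_; const; _⇔_; mk⇔; Equivalence)
open import Relation.Nullary using (¬_; Dec; yes; no; contradiction)
open import Relation.Nullary.Decidable using (_×-dec_)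
open import Relation.Unary using (Pred; Decidable)
open import Relation.Binary.PropositionalEquality
  using (_≡_; _≢_; refl; sym; trans; cong; cong₂; subst; module ≡-Reasoning)
import Data.Integer as ℤ
import Data.Integer.Properties as ℤ
open import Data.Rational as ℚ using (ℚ; toℚᵘ) renaming (_>_ to _>ℚ_)
import Data.Rational.Properties as ℚ
open import Data.Rational.Solver using (module +-*-Solver)
open import Data.Rational.Unnormalised as ℚᵘ using (mkℚᵘ; *≡*; *<*)
import Data.Rational.Unnormalised.Properties as ℚᵘ
open import Data.Nat.Tactic.RingSolver using (solve-∀)
import Algebra.Properties.CommutativeSemigroup as CommutativeSemigroupProperties
open CommutativeSemigroupProperties +-commutativeSemigroup using (interchange; xy∙z≈xz∙y)
open CommutativeSemigroupProperties *-commutativeSemigroup using (x∙yz≈y∙xz)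

-- Finite sums and counting

∑< : ℕ → (ℕ → ℕ) → ℕ
∑< zero    f = 0
∑< (suc n) f = f 0 + ∑< n (f ∘ suc)

syntax ∑< n (λ i → e) = ∑[ i < n ] e

∑-cong : ∀ n {f g : ℕ → ℕ} → (∀ i → f i ≡ g i) → ∑< n f ≡ ∑< n g
∑-cong zero    f≗g = refl
∑-cong (suc n) f≗g = cong₂ _+_ (f≗g 0) (∑-cong n (f≗g ∘ suc))

∑-+ : ∀ m n f → ∑< (m + n) f ≡ ∑< m f + ∑[ i < n ] f (m + i)
∑-+ zero    n f = refl
∑-+ (suc m) n f = trans (cong (f 0 +_) (∑-+ m n (f ∘ suc))) (sym (+-assoc (f 0) _ _))

∑-* : ∀ m n f → ∑< (m * n) f ≡ ∑[ j < m ] ∑[ t < n ] f (j * n + t)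
∑-* zero    n f = refl
∑-* (suc m) n f = begin
  ∑< (n + m * n) f                                     ≡⟨ ∑-+ n (m * n) f ⟩
  ∑< n f + ∑[ i < m * n ] f (n + i)                    ≡⟨ cong (∑< n f +_) (∑-* m n (λ i → f (n + i))) ⟩
  ∑< n f + ∑[ j < m ] ∑[ t < n ] f (n + (j * n + t))   ≡⟨ cong (∑< n f +_) (∑-cong m λ j → ∑-cong n λ t →
                                                            cong f (sym (+-assoc n (j * n) t))) ⟩
  ∑< n f + ∑[ j < m ] ∑[ t < n ] f (suc j * n + t)     ∎
  where open ≡-Reasoning

∑-const : ∀ m c → ∑[ _ < m ] c ≡ m * c
∑-const zero    c = refl
∑-const (suc m) c = cong (c +_) (∑-const m c)

∑-distrib-+ : ∀ n f g → ∑[ i < n ] (f i + g i) ≡ ∑< n f + ∑< n g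
∑-distrib-+ zero    f g = refl
∑-distrib-+ (suc n) f g =
  trans (cong (f 0 + g 0 +_) (∑-distrib-+ n (f ∘ suc) (g ∘ suc))) (interchange (f 0) (g 0) _ _)

∑-last : ∀ n f → (∀ t → t < n → f t ≡ 0) → ∑< (suc n) f ≡ f n
∑-last zero    f _     = +-identityʳ (f 0)
∑-last (suc n) f f≡0 = cong₂ _+_ (f≡0 0 (s≤s z≤n)) (∑-last n (f ∘ suc) (λ t t<n → f≡0 (suc t) (s≤s t<n)))

∑-≤ : ∀ n f → (∀ i → f i ≤ 1) → ∑< n f ≤ n
∑-≤ zero    f f≤1 = z≤n
∑-≤ (suc n) f f≤1 = +-mono-≤ (f≤1 0) (∑-≤ n (f ∘ suc) (f≤1 ∘ suc))

∑-< : ∀ n f {k} → (∀ i → f i ≤ 1) → k < n → f k ≡ 0 → ∑< n f < n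
∑-< (suc n) f {zero}  f≤1 _         f0≡0 rewrite f0≡0 = s≤s (∑-≤ n (f ∘ suc) (f≤1 ∘ suc))
∑-< (suc n) f {suc k} f≤1 (s≤s k<n) fk≡0 =
  ≤-trans (≤-reflexive (sym (+-suc (f 0) _))) (+-mono-≤ (f≤1 0) (∑-< n (f ∘ suc) (f≤1 ∘ suc) k<n fk≡0))

𝟙 : ∀ {ℓ} {A : Set ℓ} → Dec A → ℕ
𝟙 (yes _) = 1
𝟙 (no _)  = 0

𝟙≤1 : ∀ {ℓ} {A : Set ℓ} (a? : Dec A) → 𝟙 a? ≤ 1
𝟙≤1 (yes _) = s≤s z≤n
𝟙≤1 (no _)  = z≤n

𝟙-no : ∀ {ℓ} {A : Set ℓ} (a? : Dec A) → ¬ A → 𝟙 a? ≡ 0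
𝟙-no (yes a) ¬a = contradiction a ¬a
𝟙-no (no _)  _  = refl

𝟙-cong : ∀ {ℓ₁ ℓ₂} {A : Set ℓ₁} {B : Set ℓ₂} (a? : Dec A) (b? : Dec B) → A ⇔ B → 𝟙 a? ≡ 𝟙 b?
𝟙-cong (yes _) (yes _) _   = refl
𝟙-cong (yes a) (no ¬b) A⇔B = contradiction (Equivalence.to A⇔B a) ¬b
𝟙-cong (no ¬a) (yes b) A⇔B = contradiction (Equivalence.from A⇔B b) ¬a
𝟙-cong (no _)  (no _)  _   = refl

length-filter-map-applyUpTo : ∀ {ℓ} {P : Pred ℕ ℓ} (P? : Decidable P) (f g : ℕ → ℕ) n →
  length (filter P? (map f (applyUpTo g n))) ≡ ∑[ i < n ] 𝟙 (P? (f (g i)))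
length-filter-map-applyUpTo P? f g zero = refl
length-filter-map-applyUpTo P? f g (suc n) with P? (f (g 0))
... | yes _ = cong suc (length-filter-map-applyUpTo P? f (g ∘ suc) n)
... | no _  = length-filter-map-applyUpTo P? f (g ∘ suc) n

-- Euler's totient

χ : ℕ → ℕ → ℕ
χ n i = 𝟙 (coprime? (suc i) n)

φ≡∑χ : ∀ n → φ n ≡ ∑< n (χ n)
φ≡∑χ n = length-filter-map-applyUpTo (λ k → coprime? k n) suc (λ i → i) n

φ<n : ∀ {n} → 2 ≤ n → φ n < n
φ<n {suc n} (s≤s 1≤n) = subst (_< suc n) (sym (φ≡∑χ (suc n)))
  (∑-< (suc n) (χ (suc n)) (λ i → 𝟙≤1 _) ≤-refl (𝟙-no (coprime? (suc n) (suc n)) ¬coprime[n,n]))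
  where
  ¬coprime[n,n] : ¬ Coprime (suc n) (suc n)
  ¬coprime[n,n] c = <⇒≢ (s≤s 1≤n) (sym (c (∣-refl , ∣-refl)))

∤⇒coprime : ∀ {p m} → Prime p → ¬ p ∣ m → Coprime m p
∤⇒coprime p-prime p∤m (d∣m , d∣p) with prime⇒irreducible p-prime d∣p
... | inj₁ d≡1  = d≡1
... | inj₂ refl = contradiction d∣m p∤m

prime⇒>1 : ∀ {p} → Prime p → p > 1
prime⇒>1 {p} p-prime = nonTrivial⇒n>1 p {{prime⇒nonTrivial p-prime}}

coprime[m,n*o]⇒coprime[m,o] : ∀ {m n o} → Coprime m (n * o) → Coprime m o
coprime[m,n*o]⇒coprime[m,o] {n = n} c (d∣m , d∣o) = c (d∣m , ∣n⇒∣m*n n d∣o)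

coprime[m,p*o]⇒p∤m : ∀ {m p o} → Prime p → Coprime m (p * o) → ¬ p ∣ m
coprime[m,p*o]⇒p∤m {o = o} p-prime c p∣m =
  nonTrivial⇒≢1 {{prime⇒nonTrivial p-prime}} (c (p∣m , m∣m*n o))

p∤m⇒coprime[m,o]⇒coprime[m,p*o] : ∀ {m p o} → Prime p → ¬ p ∣ m → Coprime m o → Coprime m (p * o)
p∤m⇒coprime[m,o]⇒coprime[m,p*o] p-prime p∤m c (d∣m , d∣po) =
  c (d∣m , coprime-divisor (∤⇒coprime p-prime λ p∣d → p∤m (∣-trans p∣d d∣m)) d∣po)

coprime[j*n+m,n]⇔coprime[m,n] : ∀ j {m n} → Coprime (j * n + m) n ⇔ Coprime m n
coprime[j*n+m,n]⇔coprime[m,n] j = mk⇔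
  (λ c {_} (d∣m , d∣n) → c (∣m∣n⇒∣m+n (∣n⇒∣m*n j d∣n) d∣m , d∣n))
  (λ c {_} (d∣jn+m , d∣n) → c (∣m+n∣m⇒∣n d∣jn+m (∣n⇒∣m*n j d∣n) , d∣n))

coprime[m*p,n]⇔coprime[m,n] : ∀ {m p n} → Coprime p n → Coprime (m * p) n ⇔ Coprime m n
coprime[m*p,n]⇔coprime[m,n] {m} {p} p⊥n = mk⇔
  (λ c {_} (d∣m , d∣n) → c (∣m⇒∣m*n p d∣m , d∣n))
  (λ c {d} (d∣m*p , d∣n) → c (coprime-divisor (λ {_} (e∣d , e∣p) → p⊥n (e∣p , ∣-trans e∣d d∣n))
                                             (subst (d ∣_) (*-comm m p) d∣m*p) , d∣n))

-- The multiples of p in [1, p n] that are coprime to n are the p j with j ∈ [1, n] coprime to n;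
-- there are φ n of them, and removing them from the p φ n residues coprime to n leaves φ (p n).
module PrimeFactor {q n : ℕ} (p-prime : Prime (suc q)) (p⊥n : Coprime (suc q) n) where

  private
    p : ℕ
    p = suc q

    multipleOfP : ℕ → ℕ
    multipleOfP i = 𝟙 (coprime? (suc i) n ×-dec p ∣? suc i)

  χ-split : ∀ i → χ (p * n) i + multipleOfP i ≡ χ n i
  χ-split i with coprime? (suc i) (p * n) | coprime? (suc i) n | p ∣? suc i
  ... | yes _  | yes _  | no _   = refl
  ... | no _   | yes _  | yes _  = refl
  ... | no _   | no _   | _      = refl
  ... | yes c  | _      | yes p∣ = ⊥-elim (coprime[m,p*o]⇒p∤m p-prime c p∣)
  ... | yes c  | no ¬c′ | no _   = ⊥-elim (¬c′ (coprime[m,n*o]⇒coprime[m,o] {n = p} c))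
  ... | no ¬c  | yes c′ | no p∤  = ⊥-elim (¬c (p∤m⇒coprime[m,o]⇒coprime[m,p*o] p-prime p∤ c′))

  χ-periodic : ∀ j t → χ n (j * n + t) ≡ χ n t
  χ-periodic j t = 𝟙-cong (coprime? _ n) (coprime? _ n)
    (subst (λ k → Coprime k n ⇔ Coprime (suc t) n) (+-suc (j * n) t) (coprime[j*n+m,n]⇔coprime[m,n] j))

  ∑χ : ∑< (p * n) (χ n) ≡ p * φ n
  ∑χ = begin
    ∑< (p * n) (χ n)                       ≡⟨ ∑-* p n (χ n) ⟩
    ∑[ j < p ] ∑[ t < n ] χ n (j * n + t)  ≡⟨ ∑-cong p (λ j → ∑-cong n (χ-periodic j)) ⟩
    ∑[ _ < p ] ∑< n (χ n)                  ≡⟨ ∑-const p _ ⟩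
    p * ∑< n (χ n)                         ≡⟨ cong (p *_) (φ≡∑χ n) ⟨
    p * φ n                                ∎
    where open ≡-Reasoning

  multipleOfP-inner : ∀ j t → t < q → multipleOfP (j * p + t) ≡ 0
  multipleOfP-inner j t t<q = 𝟙-no (coprime? _ n ×-dec p ∣? _) (p∤ ∘ proj₂)
    where
    p∤ : ¬ p ∣ suc (j * p + t)
    p∤ p∣ = <⇒≱ (s≤s t<q) (∣⇒≤ (∣m+n∣m⇒∣n (subst (p ∣_) (sym (+-suc (j * p) t)) p∣) (n∣m*n j)))

  multipleOfP-last : ∀ j → multipleOfP (j * p + q) ≡ χ n j
  multipleOfP-last j = 𝟙-cong (coprime? _ n ×-dec p ∣? _) (coprime? (suc j) n) (subst
    (λ k → (Coprime k n × p ∣ k) ⇔ Coprime (suc j) n)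
    (trans (+-comm p (j * p)) (+-suc (j * p) q))
    (mk⇔ (Equivalence.to ⊥n ∘ proj₁) (λ c → Equivalence.from ⊥n c , n∣m*n (suc j))))
    where
    ⊥n : Coprime (suc j * p) n ⇔ Coprime (suc j) n
    ⊥n = coprime[m*p,n]⇔coprime[m,n] {suc j} p⊥n

  ∑multipleOfP : ∑< (p * n) multipleOfP ≡ φ n
  ∑multipleOfP = begin
    ∑< (p * n) multipleOfP                         ≡⟨ cong (λ k → ∑< k multipleOfP) (*-comm p n) ⟩
    ∑< (n * p) multipleOfP                         ≡⟨ ∑-* n p multipleOfP ⟩
    ∑[ j < n ] ∑[ t < p ] multipleOfP (j * p + t)  ≡⟨ ∑-cong n (λ j → ∑-last q _ (multipleOfP-inner j)) ⟩
    ∑[ j < n ] multipleOfP (j * p + q)             ≡⟨ ∑-cong n multipleOfP-last ⟩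
    ∑< n (χ n)                                     ≡⟨ φ≡∑χ n ⟨
    φ n                                            ∎
    where open ≡-Reasoning

  φ-mult : φ (p * n) + φ n ≡ p * φ n
  φ-mult = begin
    φ (p * n) + φ n                                ≡⟨ cong₂ _+_ (φ≡∑χ (p * n)) (sym ∑multipleOfP) ⟩
    ∑< (p * n) (χ (p * n)) + ∑< (p * n) multipleOfP ≡⟨ ∑-distrib-+ (p * n) (χ (p * n)) multipleOfP ⟨
    ∑[ i < p * n ] (χ (p * n) i + multipleOfP i)   ≡⟨ ∑-cong (p * n) χ-split ⟩
    ∑< (p * n) (χ n)                               ≡⟨ ∑χ ⟩
    p * φ n                                        ∎
    where open ≡-Reasoning

φ[p*n]+φ[n]≡p*φ[n] : ∀ {p n} → Prime p → Coprime p n → φ (p * n) + φ n ≡ p * φ n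
φ[p*n]+φ[n]≡p*φ[n] {suc q} p-prime p⊥n = PrimeFactor.φ-mult p-prime p⊥n
φ[p*n]+φ[n]≡p*φ[n] {zero}  ()

-- The inequality in ℕ

m<n⇒o<p⇒m*p+n*o<n*p+m*o : ∀ {m n o p} → m < n → o < p → m * p + n * o < n * p + m * o
m<n⇒o<p⇒m*p+n*o<n*p+m*o {m} {_} {o} m<n o<p with m≤n⇒∃[o]m+o≡n m<n | m≤n⇒∃[o]m+o≡n o<p
... | d , refl | e , refl =
  subst (lhs <_) (rearrange m o d e) (m<m+n lhs (s≤s z≤n))
  where
  lhs : ℕ
  lhs = m * (suc o + e) + (suc m + d) * o
  rearrange : ∀ m o d e → m * (suc o + e) + (suc m + d) * o + suc d * suc e
                          ≡ (suc m + d) * (suc o + e) + m * o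
  rearrange = solve-∀

totient-gap : ∀ {pa pb x R f A B} → A + f ≡ pb * f → B + f ≡ pa * f → f < R → 1 ≤ x → pa * x < pb →
  x * (pa * R) + 2 * A < pb * R + A * x + x * B
totient-gap {pa} {pb} {1} {R} {f} {A} {B} A+f≡pb*f B+f≡pa*f f<R _ pa*1<pb = +-cancelʳ-< f _ _ (begin-strict
  1 * (pa * R) + 2 * A + f     ≡⟨ regroup-left pa R A f ⟩
  pa * R + A + (A + f)         ≡⟨ cong (pa * R + A +_) A+f≡pb*f ⟩
  pa * R + A + pb * f          ≡⟨ xy∙z≈xz∙y (pa * R) A (pb * f) ⟩
  pa * R + pb * f + A          <⟨ +-monoˡ-< A (m<n⇒o<p⇒m*p+n*o<n*p+m*o pa<pb f<R) ⟩
  pb * R + pa * f + A          ≡⟨ xy∙z≈xz∙y (pb * R) (pa * f) A ⟩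
  pb * R + A + pa * f          ≡⟨ cong (pb * R + A +_) B+f≡pa*f ⟨
  pb * R + A + (B + f)         ≡⟨ regroup-right pb R A B f ⟩
  pb * R + A * 1 + 1 * B + f   ∎)
  where
  open ≤-Reasoning
  pa<pb : pa < pb
  pa<pb = subst (_< pb) (*-identityʳ pa) pa*1<pb
  regroup-left : ∀ pa R A f → 1 * (pa * R) + 2 * A + f ≡ pa * R + A + (A + f)
  regroup-left = solve-∀
  regroup-right : ∀ pb R A B f → pb * R + A + (B + f) ≡ pb * R + A * 1 + 1 * B + f
  regroup-right = solve-∀
totient-gap {pa} {pb} {x@(suc (suc _))} {R@(suc _)} {f} {A} {B} _ _ _ _ pa*x<pb = begin-strict
  x * (pa * R) + 2 * A     <⟨ +-monoˡ-< (2 * A) x*pa*R<pb*R ⟩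
  pb * R + 2 * A           ≤⟨ +-monoʳ-≤ (pb * R) (subst (_≤ A * x) (*-comm A 2) (*-monoʳ-≤ A (s≤s (s≤s z≤n)))) ⟩
  pb * R + A * x           ≤⟨ m≤m+n (pb * R + A * x) (x * B) ⟩
  pb * R + A * x + x * B   ∎
  where
  open ≤-Reasoning
  x*pa*R<pb*R : x * (pa * R) < pb * R
  x*pa*R<pb*R = subst (_< pb * R) (trans (cong (_* R) (*-comm pa x)) (*-assoc x pa R)) (*-monoˡ-< R pa*x<pb)

-- Transfer to ℚ

toℚᵘ-divℚ : ∀ m k → toℚᵘ (divℚ m (suc k)) ℚᵘ.≃ mkℚᵘ (ℤ.+ m) k
toℚᵘ-divℚ m k = ℚ.toℚᵘ-fromℚᵘ (mkℚᵘ (ℤ.+ m) k)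

fromℕℚ-+ : ∀ m n → fromℕℚ (m + n) ≡ fromℕℚ m ℚ.+ fromℕℚ n
fromℕℚ-+ m n = ℚ.toℚᵘ-injective (begin
  toℚᵘ (fromℕℚ (m + n))                   ≈⟨ toℚᵘ-divℚ (m + n) 0 ⟩
  mkℚᵘ (ℤ.+ (m + n)) 0                    ≡⟨ cong (λ i → mkℚᵘ i 0) (trans (ℤ.pos-+ m n)
                                               (sym (cong₂ ℤ._+_ (ℤ.*-identityʳ (ℤ.+ m)) (ℤ.*-identityʳ (ℤ.+ n))))) ⟩
  mkℚᵘ (ℤ.+ m) 0 ℚᵘ.+ mkℚᵘ (ℤ.+ n) 0      ≈⟨ ℚᵘ.+-cong (toℚᵘ-divℚ m 0) (toℚᵘ-divℚ n 0) ⟨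
  toℚᵘ (fromℕℚ m) ℚᵘ.+ toℚᵘ (fromℕℚ n)    ≈⟨ ℚ.toℚᵘ-homo-+ (fromℕℚ m) (fromℕℚ n) ⟨
  toℚᵘ (fromℕℚ m ℚ.+ fromℕℚ n)            ∎)
  where open ℚᵘ.≃-Reasoning

fromℕℚ-* : ∀ m n → fromℕℚ (m * n) ≡ fromℕℚ m ℚ.* fromℕℚ n
fromℕℚ-* m n = ℚ.toℚᵘ-injective (begin
  toℚᵘ (fromℕℚ (m * n))                   ≈⟨ toℚᵘ-divℚ (m * n) 0 ⟩
  mkℚᵘ (ℤ.+ (m * n)) 0                    ≡⟨ cong (λ i → mkℚᵘ i 0) (ℤ.pos-* m n) ⟩
  mkℚᵘ (ℤ.+ m) 0 ℚᵘ.* mkℚᵘ (ℤ.+ n) 0      ≈⟨ ℚᵘ.*-cong (toℚᵘ-divℚ m 0) (toℚᵘ-divℚ n 0) ⟨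
  toℚᵘ (fromℕℚ m) ℚᵘ.* toℚᵘ (fromℕℚ n)    ≈⟨ ℚ.toℚᵘ-homo-* (fromℕℚ m) (fromℕℚ n) ⟨
  toℚᵘ (fromℕℚ m ℚ.* fromℕℚ n)            ∎)
  where open ℚᵘ.≃-Reasoning

fromℕℚ-mono-< : ∀ {m n} → m < n → fromℕℚ m ℚ.< fromℕℚ n
fromℕℚ-mono-< {m} {n} m<n = ℚ.toℚᵘ-cancel-< (begin-strict
  toℚᵘ (fromℕℚ m)  ≃⟨ toℚᵘ-divℚ m 0 ⟩
  mkℚᵘ (ℤ.+ m) 0   <⟨ *<* (ℤ.*-monoʳ-<-pos ℤ.1ℤ (ℤ.+<+ m<n)) ⟩
  mkℚᵘ (ℤ.+ n) 0   ≃⟨ toℚᵘ-divℚ n 0 ⟨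
  toℚᵘ (fromℕℚ n)  ∎)
  where open ℚᵘ.≤-Reasoning

divℚ-*-cancel : ∀ n k x → divℚ n (suc k * suc x) ℚ.* fromℕℚ (suc x) ≡ divℚ n (suc k)
divℚ-*-cancel n k x = ℚ.toℚᵘ-injective (begin
  toℚᵘ (c ℚ.* fromℕℚ (suc x))                             ≈⟨ ℚ.toℚᵘ-homo-* c (fromℕℚ (suc x)) ⟩
  toℚᵘ c ℚᵘ.* toℚᵘ (fromℕℚ (suc x))                       ≈⟨ ℚᵘ.*-cong (toℚᵘ-divℚ n _) (toℚᵘ-divℚ (suc x) 0) ⟩
  mkℚᵘ (ℤ.+ n) (x + k * suc x) ℚᵘ.* mkℚᵘ (ℤ.+ suc x) 0    ≈⟨ *≡* cross ⟩
  mkℚᵘ (ℤ.+ n) k                                           ≈⟨ toℚᵘ-divℚ n k ⟨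
  toℚᵘ (divℚ n (suc k))                                    ∎)
  where
  open ℚᵘ.≃-Reasoning
  c : ℚ
  c = divℚ n (suc k * suc x)
  cross : (ℤ.+ n ℤ.* ℤ.+ suc x) ℤ.* ℤ.+ suc k ≡ ℤ.+ n ℤ.* ℤ.+ (suc k * suc x * 1)
  cross = trans (cong (ℤ._* ℤ.+ suc k) (sym (ℤ.pos-* n (suc x))))
         (trans (sym (ℤ.pos-* (n * suc x) (suc k)))
         (trans (cong ℤ.+_ (reorder n (suc k) (suc x))) (ℤ.pos-* n _)))
    where
    reorder : ∀ a b c → a * c * b ≡ a * (b * c * 1)
    reorder = solve-∀

fromℕℚ-gap : ∀ {x Q φQ Q′ φQ′} → x * Q′ + 2 * φQ < Q + φQ * x + x * φQ′ →
  fromℕℚ x ℚ.* (fromℕℚ Q′ ℚ.+ fromℕℚ φQ′ ℚ.* (fromℕℚ 1 ℚ.- fromℕℚ 2))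
    ℚ.< fromℕℚ Q ℚ.+ fromℕℚ φQ ℚ.* (fromℕℚ x ℚ.- fromℕℚ 2)
fromℕℚ-gap {x} {Q} {φQ} {Q′} {φQ′} gap = begin-strict
  ι x ℚ.* (ι Q′ ℚ.+ ι φQ′ ℚ.* (ι 1 ℚ.- ι 2))   ≡⟨ shift-left (ι x) (ι Q′) (ι φQ) (ι φQ′) ⟩
  ι x ℚ.* ι Q′ ℚ.+ ι 2 ℚ.* ι φQ ℚ.+ T            ≡⟨ cong (ℚ._+ T) (sym ι-lhs) ⟩
  ι (x * Q′ + 2 * φQ) ℚ.+ T                     <⟨ ℚ.+-monoˡ-< T (fromℕℚ-mono-< gap) ⟩
  ι (Q + φQ * x + x * φQ′) ℚ.+ T                ≡⟨ cong (ℚ._+ T) ι-rhs ⟩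
  ι Q ℚ.+ ι φQ ℚ.* ι x ℚ.+ ι x ℚ.* ι φQ′ ℚ.+ T  ≡⟨ shift-right (ι x) (ι Q) (ι φQ) (ι φQ′) (ι 2) ⟩
  ι Q ℚ.+ ι φQ ℚ.* (ι x ℚ.- ι 2)                ∎
  where
  open ℚ.≤-Reasoning
  open +-*-Solver using (solve; _:=_; _:+_; _:*_; :-_; _:-_; con)
  ι : ℕ → ℚ
  ι = fromℕℚ
  T : ℚ
  T = ℚ.- (ι 2 ℚ.* ι φQ) ℚ.- ι x ℚ.* ι φQ′
  ι-lhs : ι (x * Q′ + 2 * φQ) ≡ ι x ℚ.* ι Q′ ℚ.+ ι 2 ℚ.* ι φQ
  ι-lhs = trans (fromℕℚ-+ (x * Q′) (2 * φQ)) (cong₂ ℚ._+_ (fromℕℚ-* x Q′) (fromℕℚ-* 2 φQ))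
  ι-rhs : ι (Q + φQ * x + x * φQ′) ≡ ι Q ℚ.+ ι φQ ℚ.* ι x ℚ.+ ι x ℚ.* ι φQ′
  ι-rhs = trans (fromℕℚ-+ (Q + φQ * x) (x * φQ′))
            (cong₂ ℚ._+_ (trans (fromℕℚ-+ Q (φQ * x)) (cong (ι Q ℚ.+_) (fromℕℚ-* φQ x))) (fromℕℚ-* x φQ′))
  -- fromℕℚ 2 is definitionally 1ℚ ℚ.+ 1ℚ; the solver needs it as such to cancel 1 − 2.
  shift-left : ∀ x q′ φq φq′ → x ℚ.* (q′ ℚ.+ φq′ ℚ.* (ℚ.1ℚ ℚ.- (ℚ.1ℚ ℚ.+ ℚ.1ℚ)))
    ≡ x ℚ.* q′ ℚ.+ (ℚ.1ℚ ℚ.+ ℚ.1ℚ) ℚ.* φq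
        ℚ.+ (ℚ.- ((ℚ.1ℚ ℚ.+ ℚ.1ℚ) ℚ.* φq) ℚ.- x ℚ.* φq′)
  shift-left = solve 4 (λ x q′ φq φq′ →
    x :* (q′ :+ φq′ :* (con ℚ.1ℚ :- (con ℚ.1ℚ :+ con ℚ.1ℚ)))
      := x :* q′ :+ (con ℚ.1ℚ :+ con ℚ.1ℚ) :* φq
           :+ (:- ((con ℚ.1ℚ :+ con ℚ.1ℚ) :* φq) :- x :* φq′)) refl
  shift-right : ∀ x q φq φq′ two →
    q ℚ.+ φq ℚ.* x ℚ.+ x ℚ.* φq′ ℚ.+ (ℚ.- (two ℚ.* φq) ℚ.- x ℚ.* φq′) ≡ q ℚ.+ φq ℚ.* (x ℚ.- two)
  shift-right = solve 5 (λ x q φq φq′ two →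
    q :+ φq :* x :+ x :* φq′ :+ (:- (two :* φq) :- x :* φq′) := q :+ φq :* (x :- two)) refl

-- β r p e a s unfolds to β′ (φ n) n P (p a ^ (s ∸ 1)) Q (φ Q) with P = p₁⋯p_r and Q = P / p a.
β′ : (Φ n P x Q φQ : ℕ) → ℚ
β′ Φ n P x Q φQ = fromℕℚ Φ ℚ.+ divℚ n (P * x) ℚ.* (fromℕℚ Q ℚ.+ fromℕℚ φQ ℚ.* (fromℕℚ x ℚ.- fromℕℚ 2))

-- The hypothesis is x (Q′ − φQ′) < Q + φQ (x − 2), rearranged so that no subtraction occurs.
β′-< : ∀ Φ {n P x Q φQ Q′ φQ′} → 1 ≤ n → 1 ≤ P → 1 ≤ x →
  x * Q′ + 2 * φQ < Q + φQ * x + x * φQ′ → β′ Φ n P 1 Q′ φQ′ ℚ.< β′ Φ n P x Q φQ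
β′-< Φ {suc n} {suc P} {suc x} {Q} {φQ} {Q′} {φQ′} _ _ _ gap = ℚ.+-monoʳ-< (fromℕℚ Φ) (begin-strict
  divℚ (suc n) (suc P * 1) ℚ.* B        ≡⟨ cong (ℚ._* B) (trans (cong (divℚ (suc n)) (*-identityʳ (suc P)))
                                                            (sym (divℚ-*-cancel (suc n) P x))) ⟩
  c ℚ.* fromℕℚ (suc x) ℚ.* B           ≡⟨ ℚ.*-assoc c (fromℕℚ (suc x)) B ⟩
  c ℚ.* (fromℕℚ (suc x) ℚ.* B)         <⟨ ℚ.*-monoʳ-<-pos c (fromℕℚ-gap {suc x} {Q} {φQ} {Q′} {φQ′} gap) ⟩
  c ℚ.* A                              ∎)
  where
  open ℚ.≤-Reasoning
  c : ℚ
  c = divℚ (suc n) (suc P * suc x)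
  B A : ℚ
  B = fromℕℚ Q′ ℚ.+ fromℕℚ φQ′ ℚ.* (fromℕℚ 1 ℚ.- fromℕℚ 2)
  A = fromℕℚ Q ℚ.+ fromℕℚ φQ ℚ.* (fromℕℚ (suc x) ℚ.- fromℕℚ 2)
  instance
    c-positive : ℚ.Positive c
    c-positive = ℚ.normalize-pos (suc n) (suc P * suc x)

-- Products over Fin r

divℕ[m*n,m]≡n : ∀ {m} n → 1 ≤ m → divℕ (m * n) m ≡ n
divℕ[m*n,m]≡n {suc k} n _ = trans (cong (_/ suc k) (*-comm (suc k) n)) (m*n/n≡m n (suc k))

prod-updateAt : ∀ r (f : Fin r → ℕ) a → prod r f ≡ f a * prod r (updateAt f a (const 1))
prod-updateAt (suc r) f fzero    = cong (f fzero *_) (sym (+-identityʳ _))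
prod-updateAt (suc r) f (fsuc a) = trans (cong (f fzero *_) (prod-updateAt r (f ∘ fsuc) a))
                                         (x∙yz≈y∙xz (f fzero) (f (fsuc a)) _)

prod-positive : ∀ r (f : Fin r → ℕ) → (∀ i → 1 ≤ f i) → 1 ≤ prod r f
prod-positive zero    f f≥1 = s≤s z≤n
prod-positive (suc r) f f≥1 = *-mono-≤ (f≥1 fzero) (prod-positive r (f ∘ fsuc) (f≥1 ∘ fsuc))

prime∤prod : ∀ r (f : Fin r → ℕ) {q} → Prime q → (∀ i → ¬ q ∣ f i) → ¬ q ∣ prod r f
prime∤prod zero    f q-prime q∤f q∣1 = nonTrivial⇒≢1 {{prime⇒nonTrivial q-prime}} (∣1⇒≡1 q∣1)
prime∤prod (suc r) f q-prime q∤f q∣prod with euclidsLemma (f fzero) (prod r (f ∘ fsuc)) q-prime q∣prod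
... | inj₁ q∣f0   = q∤f fzero q∣f0
... | inj₂ q∣rest = prime∤prod r (f ∘ fsuc) q-prime (q∤f ∘ fsuc) q∣rest

factor≤prod : ∀ r (f : Fin r → ℕ) → (∀ i → 1 ≤ f i) → ∀ c → f c ≤ prod r f
factor≤prod (suc r) f f≥1 fzero    =
  m≤m*n (f fzero) _ {{>-nonZero (prod-positive r (f ∘ fsuc) (f≥1 ∘ fsuc))}}
factor≤prod (suc r) f f≥1 (fsuc c) =
  ≤-trans (factor≤prod r (f ∘ fsuc) (f≥1 ∘ fsuc) c) (m≤n*m _ (f fzero) {{>-nonZero (f≥1 fzero)}})

third-index : ∀ {r} → 3 ≤ r → (a b : Fin r) → ∃[ c ] c ≢ a × c ≢ b
third-index (s≤s (s≤s (s≤s _))) 0F              0F              = 1F , (λ ()) , (λ ())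
third-index (s≤s (s≤s (s≤s _))) 0F              1F              = 2F , (λ ()) , (λ ())
third-index (s≤s (s≤s (s≤s _))) 0F              (fsuc (fsuc _)) = 1F , (λ ()) , (λ ())
third-index (s≤s (s≤s (s≤s _))) 1F              0F              = 2F , (λ ()) , (λ ())
third-index (s≤s (s≤s (s≤s _))) (fsuc (fsuc _)) 0F              = 1F , (λ ()) , (λ ())
third-index (s≤s (s≤s (s≤s _))) (fsuc _)        (fsuc _)        = 0F , (λ ()) , (λ ())

strictlyIncreasing⇒injective : ∀ {r} {p : Fin r → ℕ} → (∀ i j → i <ᶠ j → p i < p j) →
  ∀ {i j} → p i ≡ p j → i ≡ j
strictlyIncreasing⇒injective {p = p} p-increasing {i} {j} pi≡pj with Fin.<-cmp i j
... | tri< i<j _ _ = contradiction pi≡pj (<⇒≢ (p-increasing i j i<j))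
... | tri≈ _ i≡j _ = i≡j
... | tri> _ _ j<i = contradiction (sym pi≡pj) (<⇒≢ (p-increasing j i j<i))

module WithoutTwoFactors {r} (p : Fin r → ℕ) (p-prime : ∀ i → Prime (p i))
    (p-injective : ∀ {i j} → p i ≡ p j → i ≡ j) {a b : Fin r} (a≢b : a ≢ b) where

  others : Fin r → ℕ
  others = updateAt (updateAt p a (const 1)) b (const 1)

  R : ℕ
  R = prod r others

  others-cases : ∀ i → others i ≡ 1 ⊎ (i ≢ a × i ≢ b × others i ≡ p i)
  others-cases i with i Fin.≟ b
  ... | yes refl = inj₁ (updateAt-updates b (updateAt p a (const 1)))
  ... | no i≢b with i Fin.≟ a
  ...   | yes refl = inj₁ (trans (updateAt-minimal a b _ i≢b) (updateAt-updates a p))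
  ...   | no i≢a   = inj₂ (i≢a , i≢b , trans (updateAt-minimal i b _ i≢b) (updateAt-minimal i a p i≢a))

  rad≡pa*pb*R : radOf r p ≡ p a * (p b * R)
  rad≡pa*pb*R = trans (prod-updateAt r p a) (cong (p a *_) (trans (prod-updateAt r (updateAt p a (const 1)) b)
                  (cong (_* R) (updateAt-minimal b a p (a≢b ∘ sym)))))

  p∤R : ∀ {k} → k ≡ a ⊎ k ≡ b → ¬ p k ∣ R
  p∤R {k} k∈ab = prime∤prod r others (p-prime k) p∤others
    where
    p≢1 : p k ≢ 1
    p≢1 = nonTrivial⇒≢1 {{prime⇒nonTrivial (p-prime k)}}
    p∤others : ∀ i → ¬ p k ∣ others i
    p∤others i p∣ with others-cases i
    ... | inj₁ ≡1 = p≢1 (∣1⇒≡1 (subst (p k ∣_) ≡1 p∣))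
    ... | inj₂ (i≢a , i≢b , ≡p) with prime⇒irreducible (p-prime i) (subst (p k ∣_) ≡p p∣)
    ...   | inj₁ p≡1 = p≢1 p≡1
    ...   | inj₂ pk≡pi = [ i≢a ∘ trans (sym k≡i) , i≢b ∘ trans (sym k≡i) ] k∈ab
      where
      k≡i : k ≡ i
      k≡i = p-injective pk≡pi

  others≥1 : ∀ i → 1 ≤ others i
  others≥1 i with others-cases i
  ... | inj₁ ≡1           = ≤-reflexive (sym ≡1)
  ... | inj₂ (_ , _ , ≡p) = subst (1 ≤_) (sym ≡p) (<⇒≤ (prime⇒>1 (p-prime i)))

  2≤R : 3 ≤ r → 2 ≤ R
  2≤R 3≤r with third-index 3≤r a b
  ... | c , c≢a , c≢b = ≤-trans (prime⇒>1 (p-prime c))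
          (subst (_≤ R) (trans (updateAt-minimal c b _ c≢b) (updateAt-minimal c a p c≢a))
                 (factor≤prod r others others≥1 c))

  Qa Qb : ℕ
  Qa = divℕ (radOf r p) (p a)
  Qb = divℕ (radOf r p) (p b)

  Qa≡pb*R : Qa ≡ p b * R
  Qa≡pb*R = trans (cong (λ m → divℕ m (p a)) rad≡pa*pb*R)
                  (divℕ[m*n,m]≡n (p b * R) (<⇒≤ (prime⇒>1 (p-prime a))))

  Qb≡pa*R : Qb ≡ p a * R
  Qb≡pa*R = trans (cong (λ m → divℕ m (p b)) (trans rad≡pa*pb*R (x∙yz≈y∙xz (p a) (p b) R)))
                  (divℕ[m*n,m]≡n (p a * R) (<⇒≤ (prime⇒>1 (p-prime b))))

  p∤R⇒φ[p*R]+φ[R]≡p*φ[R] : ∀ {k} → k ≡ a ⊎ k ≡ b → φ (p k * R) + φ R ≡ p k * φ R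
  p∤R⇒φ[p*R]+φ[R]≡p*φ[R] {k} k∈ab =
    φ[p*n]+φ[n]≡p*φ[n] (p-prime k) (Coprimality.sym (∤⇒coprime (p-prime k) (p∤R k∈ab)))

  radical-gap : 3 ≤ r → ∀ {x} → 1 ≤ x → p a * x < p b →
    x * Qb + 2 * φ Qa < Qa + φ Qa * x + x * φ Qb
  radical-gap 3≤r {x} 1≤x pa*x<pb rewrite Qa≡pb*R | Qb≡pa*R =
    totient-gap {p a} {p b} {x} {R} {φ R} {φ (p b * R)} {φ (p a * R)}
      (p∤R⇒φ[p*R]+φ[R]≡p*φ[R] (inj₂ refl)) (p∤R⇒φ[p*R]+φ[R]≡p*φ[R] (inj₁ refl)) (φ<n (2≤R 3≤r)) 1≤x pa*x<pb

proposition3p2 : (r : ℕ) → 3 ≤ r → (p e : Fin r → ℕ)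
    → (∀ i → Prime (p i)) → (∀ i j → i <ᶠ j → p i < p j) → (∀ i → 1 ≤ e i)
    → (a b : Fin r) → a <ᶠ b
    → (s : ℕ) → 1 ≤ s → s ≤ e a → p a ^ s < p b
    → β r p e a s >ℚ β r p e b 1
proposition3p2 r 3≤r p e p-prime p-increasing _ a b a<b (suc s) _ _ pa^[1+s]<pb =
  β′-< (φ (nOf r p e)) {Q = Qa} {φ Qa} {Qb} {φ Qb} n≥1 rad≥1 pa^s≥1 (radical-gap 3≤r pa^s≥1 pa^[1+s]<pb)
  where
  open WithoutTwoFactors p p-prime (strictlyIncreasing⇒injective p-increasing) (Fin.<⇒≢ a<b)
  p≥1 : ∀ i → 1 ≤ p i
  p≥1 = <⇒≤ ∘ prime⇒>1 ∘ p-prime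
  p^k≥1 : ∀ i k → 1 ≤ p i ^ k
  p^k≥1 i = m^n>0 (p i) {{>-nonZero (p≥1 i)}}
  n≥1 : 1 ≤ nOf r p e
  n≥1 = prod-positive r _ (λ i → p^k≥1 i (e i))
  rad≥1 : 1 ≤ radOf r p
  rad≥1 = prod-positive r p p≥1
  pa^s≥1 : 1 ≤ p a ^ s
  pa^s≥1 = p^k≥1 a s
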